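{- Let $T$ be a tree with at least two vertices such that its complement $\overline{T}$ is connected, and let $k\geq 2$ be an integer. Then $\gamma_{t[1,2]}(\overline{T})=\gamma_{t[1,k]}(\overline{T})=2$.
   Context: All graphs are finite and simple. $\overline{T}$ is the complement graph of $T$. A set $S\subseteq V(G)$ is a total $[1,k]$-set of a graph $G$ if every vertex $x\in V(G)$ satisfies $1\leq |N(x)\cap S|\leq k$, where $N(x)$ is the open neighborhood. If $G$ has a total $[1,k]$-set, $\gamma_{t[1,k]}(G)$ denotes the minimum cardinality of a total $[1,k]$-set of $G$. -}

module Defs where

open import Data.Nat using (ℕ; _≤_)
open import Data.Bool using (Bool; true; false; not; _∧_)
open import Data.Fin using (Fin; _≟_)
open import Data.Fin.Subset using (Subset; ∣_∣; _∩_)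
open import Data.Vec using (tabulate)
open import Data.List using (List; []; _∷_)
open import Data.List.Relation.Unary.Unique.Propositional using (Unique)
open import Data.Product using (_×_; Σ; ∃; ∃-syntax)
open import Data.Unit using (⊤)
open import Relation.Nullary using (¬_)
open import Relation.Nullary.Decidable using (⌊_⌋)
open import Relation.Binary.PropositionalEquality using (_≡_)

record Graph (n : ℕ) : Set where
  field
    adj   : Fin n → Fin n → Bool
    sym   : ∀ u v → adj u v ≡ adj v u
    irrefl : ∀ u → adj u u ≡ false
open Graph public

Adj : ∀ {n} → Graph n → Fin n → Fin n → Set
Adj G u v = adj G u v ≡ true

complement : ∀ {n} → Graph n → Graph n
complement {n} G = record
  { adj = λ u v → not (adj G u v) ∧ not ⌊ u ≟ v ⌋
  ; sym = symC
  ; irrefl = irrC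
  }
  where
  open import Relation.Binary.PropositionalEquality using (refl; cong₂; cong)
  open import Relation.Nullary using (yes; no)
  eqsym : ∀ (u v : Fin n) → ⌊ u ≟ v ⌋ ≡ ⌊ v ≟ u ⌋
  eqsym u v with u ≟ v | v ≟ u
  ... | yes _ | yes _ = refl
  ... | no _ | no _ = refl
  ... | yes p | no q = Data.Empty.⊥-elim (q (Relation.Binary.PropositionalEquality.sym p))
    where import Data.Empty
  ... | no p | yes q = Data.Empty.⊥-elim (p (Relation.Binary.PropositionalEquality.sym q))
    where import Data.Empty
  symC : ∀ u v → (not (adj G u v) ∧ not ⌊ u ≟ v ⌋) ≡ (not (adj G v u) ∧ not ⌊ v ≟ u ⌋)
  symC u v = cong₂ (λ a b → not a ∧ not b) (sym G u v) (eqsym u v)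
  irrC : ∀ u → (not (adj G u u) ∧ not ⌊ u ≟ u ⌋) ≡ false
  irrC u with u ≟ u
  ... | yes _ = Data.Bool.Properties.∧-zeroʳ (not (adj G u u))
    where import Data.Bool.Properties
  ... | no p = Data.Empty.⊥-elim (p refl)
    where import Data.Empty

data Walk {n : ℕ} (G : Graph n) : Fin n → Fin n → Set where
  here : ∀ {u} → Walk G u u
  step : ∀ {u v w} → Adj G u v → Walk G v w → Walk G u w

Connected : ∀ {n} → Graph n → Set
Connected G = ∀ u v → Walk G u v

IsWalkList : ∀ {n} → Graph n → List (Fin n) → Set
IsWalkList G [] = ⊤
IsWalkList G (x ∷ []) = ⊤
IsWalkList G (x ∷ y ∷ xs) = Adj G x y × IsWalkList G (y ∷ xs)

lastOf : ∀ {A : Set} → A → List A → A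
lastOf a [] = a
lastOf a (b ∷ bs) = lastOf b bs

IsCycle : ∀ {n} → Graph n → List (Fin n) → Set
IsCycle G (x ∷ y ∷ z ∷ rest) =
  Unique (x ∷ y ∷ z ∷ rest) × IsWalkList G (x ∷ y ∷ z ∷ rest) × Adj G (lastOf z rest) x
IsCycle G _ = Data.Empty.⊥
  where import Data.Empty

Acyclic : ∀ {n} → Graph n → Set
Acyclic G = ¬ (∃[ c ] IsCycle G c)

IsTree : ∀ {n} → Graph n → Set
IsTree G = Connected G × Acyclic G

N : ∀ {n} → Graph n → Fin n → Subset n
N G x = tabulate (adj G x)

IsTotal1k : ∀ {n} → ℕ → Graph n → Subset n → Set
IsTotal1k k G S = ∀ x → (1 ≤ ∣ N G x ∩ S ∣) × (∣ N G x ∩ S ∣ ≤ k)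

γt1k≡ : ∀ {n} → ℕ → Graph n → ℕ → Set
γt1k≡ k G m =
  (Σ _ λ S → IsTotal1k k G S × ∣ S ∣ ≡ m) × (∀ S → IsTotal1k k G S → m ≤ ∣ S ∣)

module Submission where

-- Lower bound (any graph): a vertex x has a neighbour s in S, and s has a
-- neighbour t in S; since s ~ t we have s ≠ t, so |S| ≥ 2.
--
-- Upper bound: call a, b far apart in T if they are distinct, non-adjacent and
-- have no common neighbour (distance ≥ 3).  Then {a, b} is a total [1,k]-set
-- of T̄ for every k ≥ 2: a vertex x ≠ a is T̄-adjacent to a unless x ~ a in T,
-- and then x is T̄-adjacent to b.
--
-- Such a pair exists: otherwise T has diameter ≤ 2.  Acyclicity excludes
-- cycles of length 3, 4 and 5, which forces a vertex c with two distinct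
-- neighbours to be adjacent to all other vertices (T is a star centred at c);
-- but c is the common neighbour of any vertex u and a T̄-neighbour of u, and
-- being adjacent to everything, c is isolated in T̄, contradicting connectivity.
-- Only acyclicity of T (not its connectivity) is used.

open import Defs hiding (sym)
open import Data.Nat using (ℕ; suc; _+_; _≤_; z≤n; s≤s)
open import Data.Nat.Properties using (≤-refl; ≤-trans; ≤-antisym; ≤-reflexive; +-suc; +-monoʳ-≤; n≤1+n)
open import Data.Bool using (true; false)
open import Data.Bool.Properties using (¬-not) renaming (_≟_ to _≟ᴮ_)
open import Data.Fin using (Fin; zero; suc; _≟_)
open import Data.Fin.Properties using (any?)
open import Data.Fin.Subset using (Subset; Nonempty; ∣_∣; _∩_; _∪_; _∈_; ⁅_⁆)
open import Data.Fin.Subset.Properties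
  using (x∈p∩q⁺; x∈p∩q⁻; x∈p∪q⁺; ∣p∩q∣≤∣q∣; ∣⁅x⁆∣≡1; x∈⁅x⁆; x∈p⇒∣p-x∣<∣p∣;
         x∈p∧x≢y⇒x∈p-y; nonempty?; Empty-unique; ∣⊥∣≡0)
open import Data.Vec using ([]; _∷_; tabulate)
open import Data.Vec.Properties using (lookup∘tabulate; lookup⇒[]=; []=⇒lookup)
open import Data.List using ([]; _∷_)
open import Data.List.Relation.Unary.All using ([]; _∷_)
open import Data.List.Relation.Unary.AllPairs using ([]; _∷_)
open import Data.List.Relation.Unary.Unique.Propositional using (Unique)
open import Data.Product using (_×_; _,_; proj₁; proj₂; ∃-syntax)
open import Data.Sum using (_⊎_; inj₁; inj₂)
open import Data.Unit using (tt)
open import Data.Empty using (⊥; ⊥-elim)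
open import Relation.Nullary using (¬_; Dec; yes; no; contradiction)
open import Relation.Nullary.Decidable using (_×-dec_)
open import Relation.Binary.PropositionalEquality
  using (_≡_; _≢_; refl; sym; trans; cong; cong₂; subst; ≢-sym)

∈⇒1≤∣p∣ : ∀ {n} {p : Subset n} {x} → x ∈ p → 1 ≤ ∣ p ∣
∈⇒1≤∣p∣ x∈p = ≤-trans (s≤s z≤n) (x∈p⇒∣p-x∣<∣p∣ x∈p)

∈∈⇒2≤∣p∣ : ∀ {n} {p : Subset n} {x y} → x ∈ p → y ∈ p → x ≢ y → 2 ≤ ∣ p ∣
∈∈⇒2≤∣p∣ x∈p y∈p x≢y =
  ≤-trans (s≤s (∈⇒1≤∣p∣ (x∈p∧x≢y⇒x∈p-y y∈p (≢-sym x≢y)))) (x∈p⇒∣p-x∣<∣p∣ x∈p)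

1≤∣p∣⇒Nonempty : ∀ {n} (p : Subset n) → 1 ≤ ∣ p ∣ → Nonempty p
1≤∣p∣⇒Nonempty {n} p 1≤∣p∣ with nonempty? p
... | yes inhabited = inhabited
... | no empty =
  contradiction (subst (1 ≤_) (trans (cong ∣_∣ (Empty-unique empty)) (∣⊥∣≡0 n)) 1≤∣p∣) λ ()

∣p∪q∣≤∣p∣+∣q∣ : ∀ {n} (p q : Subset n) → ∣ p ∪ q ∣ ≤ ∣ p ∣ + ∣ q ∣
∣p∪q∣≤∣p∣+∣q∣ [] [] = z≤n
∣p∪q∣≤∣p∣+∣q∣ (true ∷ p) (true ∷ q) =
  s≤s (≤-trans (∣p∪q∣≤∣p∣+∣q∣ p q) (+-monoʳ-≤ ∣ p ∣ (n≤1+n ∣ q ∣)))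
∣p∪q∣≤∣p∣+∣q∣ (true ∷ p) (false ∷ q) = s≤s (∣p∪q∣≤∣p∣+∣q∣ p q)
∣p∪q∣≤∣p∣+∣q∣ (false ∷ p) (true ∷ q) =
  ≤-trans (s≤s (∣p∪q∣≤∣p∣+∣q∣ p q)) (≤-reflexive (sym (+-suc ∣ p ∣ ∣ q ∣)))
∣p∪q∣≤∣p∣+∣q∣ (false ∷ p) (false ∷ q) = ∣p∪q∣≤∣p∣+∣q∣ p q

∣⁅x⁆∪⁅y⁆∣≡2 : ∀ {n} {x y : Fin n} → x ≢ y → ∣ ⁅ x ⁆ ∪ ⁅ y ⁆ ∣ ≡ 2
∣⁅x⁆∪⁅y⁆∣≡2 {x = x} {y} x≢y = ≤-antisym at-most-2 at-least-2
  where
  at-most-2 : ∣ ⁅ x ⁆ ∪ ⁅ y ⁆ ∣ ≤ 2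
  at-most-2 = subst (∣ ⁅ x ⁆ ∪ ⁅ y ⁆ ∣ ≤_) (cong₂ _+_ (∣⁅x⁆∣≡1 x) (∣⁅x⁆∣≡1 y))
                    (∣p∪q∣≤∣p∣+∣q∣ ⁅ x ⁆ ⁅ y ⁆)
  at-least-2 : 2 ≤ ∣ ⁅ x ⁆ ∪ ⁅ y ⁆ ∣
  at-least-2 = ∈∈⇒2≤∣p∣ (x∈p∪q⁺ (inj₁ (x∈⁅x⁆ x))) (x∈p∪q⁺ (inj₂ (x∈⁅x⁆ y))) x≢y

module _ {n : ℕ} (G : Graph n) where

  Adj⇒∈N : ∀ {x y} → Adj G x y → y ∈ N G x
  Adj⇒∈N {x} {y} x~y = lookup⇒[]= y (tabulate (adj G x)) (trans (lookup∘tabulate (adj G x) y) x~y)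

  ∈N⇒Adj : ∀ {x y} → y ∈ N G x → Adj G x y
  ∈N⇒Adj {x} {y} y∈N = trans (sym (lookup∘tabulate (adj G x) y)) ([]=⇒lookup y∈N)

  Adj-sym : ∀ {x y} → Adj G x y → Adj G y x
  Adj-sym {x} {y} x~y = trans (Graph.sym G y x) x~y

  Adj⇒≢ : ∀ {x y} → Adj G x y → x ≢ y
  Adj⇒≢ {x} x~x refl with () ← trans (sym x~x) (irrefl G x)

  non-neighbour≢neighbour : ∀ {c w y} → ¬ Adj G c w → Adj G c y → w ≢ y
  non-neighbour≢neighbour c≁w c~y refl = c≁w c~y

  Adj? : ∀ x y → Dec (Adj G x y)
  Adj? x y = adj G x y ≟ᴮ true

  NonAdjacent : Fin n → Fin n → Set
  NonAdjacent x y = x ≢ y × ¬ Adj G x y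

  CommonNeighbour : Fin n → Fin n → Set
  CommonNeighbour x y = ∃[ c ] Adj G x c × Adj G y c

  FarApart : Fin n → Fin n → Set
  FarApart x y = NonAdjacent x y × ¬ CommonNeighbour x y

  Diameter≤2 : Set
  Diameter≤2 = ∀ {x y} → x ≢ y → Adj G x y ⊎ CommonNeighbour x y

  distance-trichotomy : ∀ {x y} → x ≢ y → Adj G x y ⊎ CommonNeighbour x y ⊎ FarApart x y
  distance-trichotomy {x} {y} x≢y with Adj? x y
  ... | yes x~y = inj₁ x~y
  ... | no x≁y with any? (λ c → Adj? x c ×-dec Adj? y c)
  ...   | yes common = inj₂ (inj₁ common)
  ...   | no none = inj₂ (inj₂ ((x≢y , x≁y) , none))

  far-apart? : ∀ x y → Dec (FarApart x y)
  far-apart? x y with x ≟ y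
  ... | yes x≡y = no λ ((x≢y , _) , _) → x≢y x≡y
  ... | no x≢y with distance-trichotomy x≢y
  ...   | inj₁ x~y = no λ ((_ , x≁y) , _) → x≁y x~y
  ...   | inj₂ (inj₁ common) = no λ (_ , none) → none common
  ...   | inj₂ (inj₂ far) = yes far

complement-intro : ∀ {n} (G : Graph n) {x y} → NonAdjacent G x y → Adj (complement G) x y
complement-intro G {x} {y} (x≢y , x≁y) with x ≟ y
... | yes x≡y = contradiction x≡y x≢y
... | no _ rewrite ¬-not x≁y = refl

complement-elim : ∀ {n} (G : Graph n) {x y} → Adj (complement G) x y → NonAdjacent G x y
complement-elim G {x} {y} x~y with x ≟ y | adj G x y
... | yes _ | true = contradiction x~y λ ()
... | yes _ | false = contradiction x~y λ ()
... | no _ | true = contradiction x~y λ ()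
... | no x≢y | false = x≢y , λ ()

-- Lower bound: in any graph with a vertex x, a total [1,k]-set S has two
-- elements, namely a neighbour s ∈ S of x and a neighbour t ∈ S of s.
total-set-size≥2 : ∀ {n} k (G : Graph n) → Fin n → ∀ S → IsTotal1k k G S → 2 ≤ ∣ S ∣
total-set-size≥2 k G x S total =
  let s , s∈N∩S = 1≤∣p∣⇒Nonempty (N G x ∩ S) (proj₁ (total x))
      t , t∈N∩S = 1≤∣p∣⇒Nonempty (N G s ∩ S) (proj₁ (total s))
      _ , s∈S = x∈p∩q⁻ (N G x) S s∈N∩S
      t∈N , t∈S = x∈p∩q⁻ (N G s) S t∈N∩S
  in ∈∈⇒2≤∣p∣ s∈S t∈S (Adj⇒≢ G (∈N⇒Adj G t∈N))

-- Every vertex is distinct from and non-adjacent to one of two vertices a, b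
-- that are far apart: if x ≠ a is adjacent to a, then x ≠ b and x ≁ b, as b
-- is not a neighbour of a and a, b have no common neighbour.
nonadjacent-to-far-pair : ∀ {n} (G : Graph n) {a b} → FarApart G a b →
  ∀ x → NonAdjacent G x a ⊎ NonAdjacent G x b
nonadjacent-to-far-pair G {a} {b} ((a≢b , a≁b) , no-common) x with x ≟ a
... | yes refl = inj₂ (a≢b , a≁b)
... | no x≢a with Adj? G x a
...   | no x≁a = inj₁ (x≢a , x≁a)
...   | yes x~a = inj₂ (x≢b , x≁b)
  where
  x≢b : x ≢ b
  x≢b refl = a≁b (Adj-sym G x~a)
  x≁b : ¬ Adj G x b
  x≁b x~b = no-common (x , Adj-sym G x~a , Adj-sym G x~b)

far-pair-total : ∀ {n} (T : Graph n) {a b} → FarApart T a b →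
  ∀ k → 2 ≤ k → IsTotal1k k (complement T) (⁅ a ⁆ ∪ ⁅ b ⁆)
far-pair-total {n} T {a} {b} far k 2≤k x = at-least-one , at-most-k
  where
  T̄ : Graph n
  T̄ = complement T
  S : Subset n
  S = ⁅ a ⁆ ∪ ⁅ b ⁆
  neighbour-in-S : ∀ {y} → y ∈ S → Adj T̄ x y → 1 ≤ ∣ N T̄ x ∩ S ∣
  neighbour-in-S y∈S x~y = ∈⇒1≤∣p∣ (x∈p∩q⁺ (Adj⇒∈N T̄ x~y , y∈S))
  at-least-one : 1 ≤ ∣ N T̄ x ∩ S ∣
  at-least-one with nonadjacent-to-far-pair T far x
  ... | inj₁ x-apart-a = neighbour-in-S (x∈p∪q⁺ (inj₁ (x∈⁅x⁆ a))) (complement-intro T x-apart-a)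
  ... | inj₂ x-apart-b = neighbour-in-S (x∈p∪q⁺ (inj₂ (x∈⁅x⁆ b))) (complement-intro T x-apart-b)
  at-most-k : ∣ N T̄ x ∩ S ∣ ≤ k
  at-most-k = ≤-trans (∣p∩q∣≤∣q∣ (N T̄ x) S)
                      (subst (_≤ k) (sym (∣⁅x⁆∪⁅y⁆∣≡2 (proj₁ (proj₁ far)))) 2≤k)

module _ {n : ℕ} {G : Graph n} (acyclic : Acyclic G) where

  no-triangle : ∀ {a b c} → Adj G a b → Adj G b c → Adj G c a → ⊥
  no-triangle {a} {b} {c} ab bc ca = acyclic ((a ∷ b ∷ c ∷ []) , distinct , (ab , bc , tt) , ca)
    where
    distinct : Unique (a ∷ b ∷ c ∷ [])
    distinct = (Adj⇒≢ G ab ∷ ≢-sym (Adj⇒≢ G ca) ∷ []) ∷ (Adj⇒≢ G bc ∷ []) ∷ [] ∷ []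

  no-4-cycle : ∀ {a b c d} → Adj G a b → Adj G b c → Adj G c d → Adj G d a →
    a ≢ c → b ≢ d → ⊥
  no-4-cycle {a} {b} {c} {d} ab bc cd da a≢c b≢d =
    acyclic ((a ∷ b ∷ c ∷ d ∷ []) , distinct , (ab , bc , cd , tt) , da)
    where
    distinct : Unique (a ∷ b ∷ c ∷ d ∷ [])
    distinct = (Adj⇒≢ G ab ∷ a≢c ∷ ≢-sym (Adj⇒≢ G da) ∷ [])
             ∷ (Adj⇒≢ G bc ∷ b≢d ∷ []) ∷ (Adj⇒≢ G cd ∷ []) ∷ [] ∷ []

  no-5-cycle : ∀ {a b c d e} → Adj G a b → Adj G b c → Adj G c d → Adj G d e → Adj G e a →
    a ≢ c → a ≢ d → b ≢ d → b ≢ e → c ≢ e → ⊥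
  no-5-cycle {a} {b} {c} {d} {e} ab bc cd de ea a≢c a≢d b≢d b≢e c≢e =
    acyclic ((a ∷ b ∷ c ∷ d ∷ e ∷ []) , distinct , (ab , bc , cd , de , tt) , ea)
    where
    distinct : Unique (a ∷ b ∷ c ∷ d ∷ e ∷ [])
    distinct = (Adj⇒≢ G ab ∷ a≢c ∷ a≢d ∷ ≢-sym (Adj⇒≢ G ea) ∷ [])
             ∷ (Adj⇒≢ G bc ∷ b≢d ∷ b≢e ∷ []) ∷ (Adj⇒≢ G cd ∷ c≢e ∷ [])
             ∷ (Adj⇒≢ G de ∷ []) ∷ [] ∷ []

  -- A vertex w at distance 2 from c, via m, is not within distance 2 of
  -- another neighbour y of c: w ~ y closes the 4-cycle w m c y, and a common
  -- neighbour d of w and y closes the 5-cycle w m c y d.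
  no-second-route : Diameter≤2 G → ∀ {c w m y} → NonAdjacent G c w →
    Adj G c m → Adj G w m → Adj G c y → y ≢ m → ⊥
  no-second-route diam {c} {w} {m} {y} (c≢w , c≁w) c~m w~m c~y y≢m
    with diam (non-neighbour≢neighbour G c≁w c~y)
  ... | inj₁ w~y =
    no-4-cycle w~m (Adj-sym G c~m) c~y (Adj-sym G w~y) (≢-sym c≢w) (≢-sym y≢m)
  ... | inj₂ (d , w~d , y~d) =
    no-5-cycle w~m (Adj-sym G c~m) c~y y~d (Adj-sym G w~d)
               (≢-sym c≢w) (non-neighbour≢neighbour G c≁w c~y) (≢-sym y≢m) m≢d c≢d
    where
    m≢d : m ≢ d
    m≢d refl = no-triangle c~y y~d (Adj-sym G c~m)
    c≢d : c ≢ d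
    c≢d refl = c≁w (Adj-sym G w~d)

  -- Otherwise w and c have a
  -- common neighbour m, and one of the two neighbours of c differs from m.
  centre-dominates : Diameter≤2 G → ∀ {c x y} → Adj G c x → Adj G c y → x ≢ y →
    ∀ {w} → ¬ NonAdjacent G c w
  centre-dominates diam {x = x} c~x c~y x≢y (c≢w , c≁w) with diam c≢w
  ... | inj₁ c~w = c≁w c~w
  ... | inj₂ (m , c~m , w~m) with m ≟ x
  ...   | yes refl = no-second-route diam (c≢w , c≁w) c~m w~m c~y (≢-sym x≢y)
  ...   | no m≢x = no-second-route diam (c≢w , c≁w) c~m w~m c~x (≢-sym m≢x)

another-vertex : ∀ {n} → 2 ≤ n → (c : Fin n) → ∃[ z ] c ≢ z
another-vertex (s≤s (s≤s z≤n)) zero = suc zero , λ ()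
another-vertex (s≤s (s≤s z≤n)) (suc _) = zero , λ ()

-- If the complement of G is connected and G has at least two vertices, every
-- vertex c has a non-neighbour in G: the first step of a walk in Ḡ from c to z ≠ c.
has-non-neighbour : ∀ {n} (G : Graph n) → 2 ≤ n → Connected (complement G) →
  ∀ c → ∃[ w ] NonAdjacent G c w
has-non-neighbour G 2≤n connected c with another-vertex 2≤n c
... | z , c≢z with connected c z
...   | here = contradiction refl c≢z
...   | step {v = w} c~w _ = w , complement-elim G c~w

-- An acyclic graph of diameter at most 2 on at least two vertices is a star,
-- so its complement is disconnected: a non-adjacent pair u, v has a common
-- neighbour c, which then dominates the graph, but c has a non-neighbour.
diameter≤2⇒disconnected-complement : ∀ {n} (G : Graph n) → 2 ≤ n → Acyclic G →
  Diameter≤2 G → ¬ Connected (complement G)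
diameter≤2⇒disconnected-complement {suc _} G 2≤n acyclic diam connected
  with has-non-neighbour G 2≤n connected zero
... | v , (u≢v , u≁v) with diam u≢v
...   | inj₁ u~v = u≁v u~v
...   | inj₂ (c , u~c , v~c) =
  centre-dominates acyclic diam (Adj-sym G u~c) (Adj-sym G v~c) u≢v
                   (proj₂ (has-non-neighbour G 2≤n connected c))

far-pair-exists : ∀ {n} (G : Graph n) → 2 ≤ n → Acyclic G → Connected (complement G) →
  ∃[ a ] ∃[ b ] FarApart G a b
far-pair-exists G 2≤n acyclic connected with any? (λ a → any? (λ b → far-apart? G a b))
... | yes far-pair = far-pair
... | no no-far-pair =
  ⊥-elim (diameter≤2⇒disconnected-complement G 2≤n acyclic diameter≤2 connected)
  where
  diameter≤2 : Diameter≤2 G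
  diameter≤2 {x} {y} x≢y with distance-trichotomy G x≢y
  ... | inj₁ x~y = inj₁ x~y
  ... | inj₂ (inj₁ common) = inj₂ common
  ... | inj₂ (inj₂ far) = ⊥-elim (no-far-pair (x , y , far))

γ-complement-acyclic : ∀ {n} (G : Graph n) → 2 ≤ n → Acyclic G → Connected (complement G) →
  ∀ k → 2 ≤ k → γt1k≡ k (complement G) 2
γ-complement-acyclic G 2≤n acyclic connected k 2≤k
  with a , b , far ← far-pair-exists G 2≤n acyclic connected =
  (⁅ a ⁆ ∪ ⁅ b ⁆ , far-pair-total G far k 2≤k , ∣⁅x⁆∪⁅y⁆∣≡2 (proj₁ (proj₁ far))) ,
  λ S total → total-set-size≥2 k (complement G) a S total

lemma3p3 : (n : ℕ) (T : Graph n) → 2 ≤ n → IsTree T → Connected (complement T) →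
    (k : ℕ) → 2 ≤ k →
    γt1k≡ 2 (complement T) 2 × γt1k≡ k (complement T) 2
lemma3p3 n T 2≤n (_ , acyclic) connected k 2≤k =
  γ-complement-acyclic T 2≤n acyclic connected 2 ≤-refl ,
  γ-complement-acyclic T 2≤n acyclic connected k 2≤k
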